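{- Let $\mathcal V$ be a quantale, $(T,\eta,\mu)$ a monad on $\mathsf{Set}$ with $\Lambda^T=\{ev_T\}$ where $ev_T\colon T\mathcal V\to\mathcal V$ is a $T$-algebra, and $F$ a polynomial functor with finite coproducts with its recursively defined evaluation maps $\Lambda^F$, where for each constant functor $K_B$ occurring in $F$ a $T$-algebra $\zeta^B\colon TB\to B$ is chosen and every evaluation map $ev\colon B\to\mathcal V$ in $\Lambda^{K_B}$ is a $T$-algebra homomorphism from $\zeta^B$ to $ev_T$ (i.e. $ev\circ\zeta^B=ev_T\circ T(ev)$). Let $g\colon T((-)+(-))\Rightarrow T(-)+T(-)$ be a natural transformation that is well-behaved with respect to $ev_T$, and let $\zeta=\zeta^F\colon TF\Rightarrow FT$ be the recursively constructed transformation. Then $$\{e\circ\zeta_{\mathcal V}\mid e\in\Lambda^F*\Lambda^T\}=\Lambda^T*\Lambda^F.$$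
   Context: A quantale $\mathcal V$ is a complete lattice $(\mathcal V,\sqsubseteq)$ (top $\top$, bottom $\bot$) with a commutative monoid structure satisfying $a\otimes\bigsqcup_i b_i=\bigsqcup_i(a\otimes b_i)$. For functors $H_1,H_2$ with sets $\Lambda^{H_1}$, $\Lambda^{H_2}$ of maps $H_1\mathcal V\to\mathcal V$, $H_2\mathcal V\to\mathcal V$, define $\Lambda^{H_1}*\Lambda^{H_2}=\{e_1\circ H_1(e_2)\mid e_1\in\Lambda^{H_1},e_2\in\Lambda^{H_2}\}$ (maps $H_1H_2\mathcal V\to\mathcal V$). Polynomial functors with finite coproducts are generated by $F::=K_B\mid\mathrm{Id}\mid\prod_{i\in I}F_i\mid F_1+F_2$ ($K_B$ constant at a set $B$, $I$ arbitrary), with evaluation maps: for $K_B$ a chosen set of maps $B\to\mathcal V$; $\Lambda^{\mathrm{Id}}=\{\mathrm{id}_{\mathcal V}\}$; for $\prod_iF_i$, $\{ev_i\circ\pi'_i\mid i\in I,ev_i\in\Lambda^{F_i}\}$ ($\pi'_i$ projections); for $F_1+F_2$, $\{[ev_1,\top]\mid ev_1\in\Lambda^{F_1}\}\cup\{[\bot,ev_2]\mid ev_2\in\Lambda^{F_2}\}\cup\{[\bot,\top]\}$ ($\top,\bot$ constant maps, $[\cdot,\cdot]$ copairing). The transformation $\zeta^F\colon TF\Rightarrow FT$ is defined recursively: $\zeta^{K_B}=\zeta^B$; $\zeta^{\mathrm{Id}}=\mathrm{id}_T$; $\zeta^{\prod_iF_i}_X=\langle\zeta^{F_i}_X\circ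 T\pi_i\rangle_{i}$; $\zeta^{F_1+F_2}_X=(\zeta^{F_1}_X+\zeta^{F_2}_X)\circ g_{F_1X,F_2X}$. The transformation $g$ is well-behaved w.r.t. $ev_T$ if for all sets $X_1,X_2$ and maps $f_i\colon X_i\to\mathcal V$: $ev_T\circ T[f_1,\top_{X_2}]=[ev_T\circ Tf_1,\top_{TX_2}]\circ g_{X_1,X_2}$, $ev_T\circ T[\bot_{X_1},f_2]=[\bot_{TX_1},ev_T\circ Tf_2]\circ g_{X_1,X_2}$, and $ev_T\circ T[\bot_{X_1},\top_{X_2}]=[\bot_{TX_1},\top_{TX_2}]\circ g_{X_1,X_2}$, where $\top_Z,\bot_Z$ are the constant maps $Z\to\mathcal V$. -}

module Defs where

open import Data.Empty using (⊥; ⊥-elim)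
open import Data.Unit using (⊤; tt)
open import Data.Product using (Σ; ∃; _×_; _,_)
open import Data.Sum using (_⊎_; inj₁; inj₂; [_,_])
import Data.Sum as Sum
open import Function using (_∘_; id; const)
open import Relation.Binary.PropositionalEquality using (_≡_)

record Quantale : Set₁ where
  infix 4 _⊑_
  infixl 7 _⊗_
  field
    Carrier   : Set
    _⊑_       : Carrier → Carrier → Set
    ⊑-refl    : ∀ {a} → a ⊑ a
    ⊑-trans   : ∀ {a b c} → a ⊑ b → b ⊑ c → a ⊑ c
    ⊑-antisym : ∀ {a b} → a ⊑ b → b ⊑ a → a ≡ b
    ⨆         : {I : Set} → (I → Carrier) → Carrier
    ⨆-upper   : ∀ {I : Set} (f : I → Carrier) (i : I) → f i ⊑ ⨆ f
    ⨆-least   : ∀ {I : Set} (f : I → Carrier) (c : Carrier) →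
                (∀ i → f i ⊑ c) → ⨆ f ⊑ c
    _⊗_       : Carrier → Carrier → Carrier
    unit      : Carrier
    ⊗-assoc   : ∀ a b c → (a ⊗ b) ⊗ c ≡ a ⊗ (b ⊗ c)
    ⊗-comm    : ∀ a b → a ⊗ b ≡ b ⊗ a
    ⊗-unit    : ∀ a → unit ⊗ a ≡ a
    ⊗-distrib : ∀ a {I : Set} (b : I → Carrier) → a ⊗ ⨆ b ≡ ⨆ (λ i → a ⊗ b i)

  top : Carrier
  top = ⨆ {Carrier} (λ x → x)

  bot : Carrier
  bot = ⨆ {⊥} ⊥-elim

-- Monads on Set (equality of functions = pointwise equality)

record Monad : Set₁ where
  field
    T       : Set → Set
    fmap    : ∀ {A B : Set} → (A → B) → T A → T B
    fmap-cong : ∀ {A B : Set} {f g : A → B} → (∀ x → f x ≡ g x) →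
                ∀ t → fmap f t ≡ fmap g t
    fmap-id : ∀ {A : Set} (t : T A) → fmap id t ≡ t
    fmap-∘  : ∀ {A B C : Set} (f : B → C) (g : A → B) (t : T A) →
              fmap (f ∘ g) t ≡ fmap f (fmap g t)
    η       : ∀ {A : Set} → A → T A
    μ       : ∀ {A : Set} → T (T A) → T A
    η-nat   : ∀ {A B : Set} (f : A → B) (x : A) → fmap f (η x) ≡ η (f x)
    μ-nat   : ∀ {A B : Set} (f : A → B) (t : T (T A)) →
              fmap f (μ t) ≡ μ (fmap (fmap f) t)
    unitˡ   : ∀ {A : Set} (t : T A) → μ (η t) ≡ t
    unitʳ   : ∀ {A : Set} (t : T A) → μ (fmap η t) ≡ t
    assoc   : ∀ {A : Set} (t : T (T (T A))) → μ (μ t) ≡ μ (fmap μ t)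

module _ (M : Monad) where
  open Monad M

  IsAlgebra : {A : Set} → (T A → A) → Set
  IsAlgebra {A} a = (∀ (x : A) → a (η x) ≡ x) × (∀ (t : T (T A)) → a (μ t) ≡ a (fmap a t))

  IsHom : {A B : Set} → (T A → A) → (T B → B) → (A → B) → Set
  IsHom a b h = ∀ t → h (a t) ≡ b (fmap h t)

-- Sets of evaluation maps, represented as indexed families of maps A → V.

record Fam (V A : Set) : Set₁ where
  field
    Ix : Set
    at : Ix → A → V
open Fam public

star : {V : Set} {H1 : Set → Set} → (map1 : ∀ {X Y : Set} → (X → Y) → H1 X → H1 Y) →
       {C : Set} → Fam V (H1 V) → Fam V C → Fam V (H1 C)
star map1 L1 L2 = record { Ix = Ix L1 × Ix L2 ; at = λ { (i , j) → at L1 i ∘ map1 (at L2 j) } }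

precomp : {V A B : Set} → Fam V A → (B → A) → Fam V B
precomp L k = record { Ix = Ix L ; at = λ i → at L i ∘ k }

SameSet : {V A : Set} → Fam V A → Fam V A → Set
SameSet L1 L2 =
  (∀ i → ∃ λ j → ∀ x → at L1 i x ≡ at L2 j x) ×
  (∀ j → ∃ λ i → ∀ x → at L2 j x ≡ at L1 i x)

-- The constant functor K carries: the set B, the chosen map ζ^B : T B → B,
-- and the chosen set Λ^{K_B} of evaluation maps B → V (as a family J → (B → V)).

module Poly (M : Monad) (Q : Quantale) where
  open Monad M
  open Quantale Q renaming (Carrier to V)

  data PF : Set₁ where
    K   : (B : Set) → (ζB : T B → B) → (J : Set) → (evs : J → B → V) → PF
    Id  : PF
    Π   : (I : Set) → (I → PF) → PF
    _⊕_ : PF → PF → PF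

  ⟦_⟧ : PF → Set → Set
  ⟦ K B _ _ _ ⟧ X = B
  ⟦ Id ⟧ X = X
  ⟦ Π I F ⟧ X = (i : I) → ⟦ F i ⟧ X
  ⟦ F₁ ⊕ F₂ ⟧ X = ⟦ F₁ ⟧ X ⊎ ⟦ F₂ ⟧ X

  pmap : (F : PF) → ∀ {X Y : Set} → (X → Y) → ⟦ F ⟧ X → ⟦ F ⟧ Y
  pmap (K B _ _ _) f b = b
  pmap Id f x = f x
  pmap (Π I F) f h = λ i → pmap (F i) f (h i)
  pmap (F₁ ⊕ F₂) f (inj₁ x) = inj₁ (pmap F₁ f x)
  pmap (F₁ ⊕ F₂) f (inj₂ y) = inj₂ (pmap F₂ f y)

  Λ : (F : PF) → Fam V (⟦ F ⟧ V)
  Λ (K B _ J evs) = record { Ix = J ; at = evs }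
  Λ Id = record { Ix = ⊤ ; at = λ _ → id }
  Λ (Π I F) = record { Ix = Σ I (λ i → Ix (Λ (F i)))
                     ; at = λ { (i , j) h → at (Λ (F i)) j (h i) } }
  Λ (F₁ ⊕ F₂) = record { Ix = Ix (Λ F₁) ⊎ (Ix (Λ F₂) ⊎ ⊤) ; at = ev }
    where
    ev : Ix (Λ F₁) ⊎ (Ix (Λ F₂) ⊎ ⊤) → ⟦ F₁ ⟧ V ⊎ ⟦ F₂ ⟧ V → V
    ev (inj₁ j)        = [ at (Λ F₁) j , const top ]
    ev (inj₂ (inj₁ j)) = [ const bot , at (Λ F₂) j ]
    ev (inj₂ (inj₂ _)) = [ const bot , const top ]

  ΛT : (T V → V) → Fam V (T V)
  ΛT evT = record { Ix = ⊤ ; at = λ _ → evT }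

  Admissible : (T V → V) → PF → Set
  Admissible evT (K B ζB J evs) = IsAlgebra M ζB × (∀ j → IsHom M ζB evT (evs j))
  Admissible evT Id = ⊤
  Admissible evT (Π I F) = ∀ i → Admissible evT (F i)
  Admissible evT (F₁ ⊕ F₂) = Admissible evT F₁ × Admissible evT F₂

  Distr : Set₁
  Distr = ∀ {X₁ X₂ : Set} → T (X₁ ⊎ X₂) → T X₁ ⊎ T X₂

  IsNatural : Distr → Set₁
  IsNatural g = ∀ {X₁ X₂ Y₁ Y₂ : Set} (f₁ : X₁ → Y₁) (f₂ : X₂ → Y₂) (t : T (X₁ ⊎ X₂)) →
                g (fmap (Sum.map f₁ f₂) t) ≡ Sum.map (fmap f₁) (fmap f₂) (g t)

  WellBehaved : (T V → V) → Distr → Set₁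
  WellBehaved evT g =
    (∀ {X₁ X₂ : Set} (f₁ : X₁ → V) (t : T (X₁ ⊎ X₂)) →
       evT (fmap [ f₁ , const {B = X₂} top ] t)
         ≡ [ evT ∘ fmap f₁ , const {B = T X₂} top ] (g t)) ×
    (∀ {X₁ X₂ : Set} (f₂ : X₂ → V) (t : T (X₁ ⊎ X₂)) →
       evT (fmap [ const {B = X₁} bot , f₂ ] t)
         ≡ [ const {B = T X₁} bot , evT ∘ fmap f₂ ] (g t)) ×
    (∀ {X₁ X₂ : Set} (t : T (X₁ ⊎ X₂)) →
       evT (fmap [ const {B = X₁} bot , const {B = X₂} top ] t)
         ≡ [ const {B = T X₁} bot , const {B = T X₂} top ] (g t))

  ζ : (F : PF) → Distr → ∀ {X : Set} → T (⟦ F ⟧ X) → ⟦ F ⟧ (T X)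
  ζ (K B ζB _ _) g t = ζB t
  ζ Id g t = t
  ζ (Π I F) g t = λ i → ζ (F i) g (fmap (λ h → h i) t)
  ζ (F₁ ⊕ F₂) g t = Sum.map (ζ F₁ g) (ζ F₂ g) (g t)

{-# OPTIONS --safe #-}
module Submission where

-- Every evaluation map e ∈ Λ^F is a homomorphism from the lifted structure
-- F(ev_T) ∘ ζ_V on F V to ev_T, i.e. e ∘ F(ev_T) ∘ ζ_V = ev_T ∘ T e; hence both
-- sets in the theorem consist of the maps ev_T ∘ T e. The homomorphism property
-- is proved by induction on F: constants hold by hypothesis, products by
-- functoriality of T, and coproducts because g is well-behaved w.r.t. ev_T.

open import Defs
open import Data.Unit using (tt)
open import Data.Product using (_,_)
open import Data.Sum using (inj₁; inj₂; [_,_]′)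
import Data.Sum as Sum
open import Function using (_∘_; _$_)
open import Relation.Binary.PropositionalEquality using (_≡_; refl; sym; trans; cong)

module Lifting (M : Monad) (Q : Quantale) where
  open Monad M
  open Quantale Q renaming (Carrier to V)
  open Poly M Q

  module _ (evT : T V → V) (g : Distr) where

    lifted : (F : PF) → T (⟦ F ⟧ V) → ⟦ F ⟧ V
    lifted F = pmap F evT ∘ ζ F g

    copair-lifted : (F₁ F₂ : PF) {a : ⟦ F₁ ⟧ V → V} {b : ⟦ F₂ ⟧ V → V}
                    {a′ : T (⟦ F₁ ⟧ V) → V} {b′ : T (⟦ F₂ ⟧ V) → V} →
                    (∀ y → a (lifted F₁ y) ≡ a′ y) → (∀ y → b (lifted F₂ y) ≡ b′ y) →
                    ∀ s → [ a , b ]′ (pmap (F₁ ⊕ F₂) evT (Sum.map (ζ F₁ g) (ζ F₂ g) s))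
                          ≡ [ a′ , b′ ]′ s
    copair-lifted F₁ F₂ p q (inj₁ y) = p y
    copair-lifted F₁ F₂ p q (inj₂ y) = q y

    Λ-isHom : WellBehaved evT g → (F : PF) → Admissible evT F →
              ∀ i → IsHom M (lifted F) evT (at (Λ F) i)
    Λ-isHom wb (K _ _ _ _) (_ , evs-isHom) = evs-isHom
    Λ-isHom wb Id _ _ x = cong evT (sym (fmap-id x))
    Λ-isHom wb (Π I F) ad (i , j) x =
      trans (Λ-isHom wb (F i) (ad i) j (fmap (_$ i) x))
            (cong evT (sym (fmap-∘ (at (Λ (F i)) j) (_$ i) x)))
    Λ-isHom wb@(wb₁ , _ , _) (F₁ ⊕ F₂) (ad₁ , _) (inj₁ j) x =
      trans (copair-lifted F₁ F₂ (Λ-isHom wb F₁ ad₁ j) (λ _ → refl) (g x))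
            (sym (wb₁ (at (Λ F₁) j) x))
    Λ-isHom wb@(_ , wb₂ , _) (F₁ ⊕ F₂) (_ , ad₂) (inj₂ (inj₁ j)) x =
      trans (copair-lifted F₁ F₂ (λ _ → refl) (Λ-isHom wb F₂ ad₂ j) (g x))
            (sym (wb₂ (at (Λ F₂) j) x))
    Λ-isHom (_ , _ , wb₃) (F₁ ⊕ F₂) _ (inj₂ (inj₂ tt)) x =
      trans (copair-lifted F₁ F₂ (λ _ → refl) (λ _ → refl) (g x)) (sym (wb₃ x))

mainTheorem12 : (M : Monad) (Q : Quantale) →
    let open Monad M in
    let open Quantale Q renaming (Carrier to V) in
    let open Poly M Q in
    (evT : T V → V) → IsAlgebra M evT →
    (F : PF) → Admissible evT F →
    (g : Distr) → IsNatural g → WellBehaved evT g →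
    SameSet (precomp (star (pmap F) (Λ F) (ΛT evT)) (ζ F g {V}))
    (star fmap (ΛT evT) (Λ F))
mainTheorem12 M Q evT _ F ad g _ wb =
  (λ { (i , tt) → (tt , i) , Λ-isHom evT g wb F ad i }) ,
  (λ { (tt , i) → (i , tt) , sym ∘ Λ-isHom evT g wb F ad i })
  where open Lifting M Q
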